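{- In ABC, strong bisimilarity $\sim$ is a congruence for all operators: for all ABC expressions $P,Q,R$, all $\alpha\in Act$, all $c\in H$ and all relabellings $f$, if $P\sim Q$ then $\alpha.P\sim\alpha.Q$, $P+R\sim Q+R$, $R+P\sim R+Q$, $P|R\sim Q|R$, $R|P\sim R|Q$, $P\backslash c\sim Q\backslash c$ and $P[f]\sim Q[f]$.
   Context: ABC (Algebra of Broadcast Communication) is parametrised by sets $\mathcal A$ of agent identifiers, $\mathcal B$ of broadcast names and $\mathcal C$ of handshake communication names. Let $\bar{\mathcal C}=\{\bar c\mid c\in\mathcal C\}$, $H=\mathcal C\cup\bar{\mathcal C}$ (disjoint union; the handshake actions), with $\bar{\bar c}=c$; $\mathcal B!=\{b!\mid b\in\mathcal B\}$ (broadcast actions), $\mathcal B?=\{b?\mid b\in\mathcal B\}$ (receive actions), and $Act=\mathcal B!\cup\mathcal B?\cup H\cup\{\tau\}$ (disjoint union). A relabelling is a function $f$ mapping $\mathcal B$ into $\mathcal B$ and $\mathcal C$ into $\mathcal C$, extended to $Act$ by $f(\bar c)=\overline{f(c)}$, $f(b\sharp)=f(b)\sharp$ for $\sharp\in\{!,?\}$, $f(\tau)=\tau$. ABC expressions are generated by $0$, $\alpha.E$ ($\alpha\in Act$), $E+F$, $E|F$, $E\backslash c$ ($c\in H$), $E[f]$ ($f$ a relabelling), and $A\in\mathcal A$; each $A\in\mathcal A$ has a defining equation $A\stackrel{def}{=}P$ with $P$ guarded (each agent identifier in $P$ occurs within the scope of a prefix). The transition relation $\to\subseteq \mathcal T_{ABC}\times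 Act\times\mathcal T_{ABC}$ (where $\mathcal T_{ABC}$ is the set of expressions) is the least relation closed under the following rules, where $\alpha,\ell\in Act$, $\eta\in H\cup\{\tau\}$, $c\in H$, $b\in\mathcal B$: (Act) $\alpha.E\xrightarrow{\alpha}E$; (Sum-l) $E\xrightarrow{\alpha}E'$ implies $E+F\xrightarrow{\alpha}E'$; (Sum-r) $F\xrightarrow{\alpha}F'$ implies $E+F\xrightarrow{\alpha}F'$; (Par-l) $E\xrightarrow{\eta}E'$ implies $E|F\xrightarrow{\eta}E'|F$; (Par-r) $F\xrightarrow{\eta}F'$ implies $E|F\xrightarrow{\eta}E|F'$; (Comm) $E\xrightarrow{c}E'$ and $F\xrightarrow{\bar c}F'$ imply $E|F\xrightarrow{\tau}E'|F'$; (Bro-l) $E\xrightarrow{b\sharp_1}E'$ with $\sharp_1\in\{!,?\}$ and $F$ having no outgoing $b?$-transition imply $E|F\xrightarrow{b\sharp_1}E'|F$; (Bro-r) symmetrically $F\xrightarrow{b\sharp_2}F'$ and $E$ having no outgoing $b?$-transition imply $E|F\xrightarrow{b\sharp_2}E|F'$; (Bro-c) $E\xrightarrow{b\sharp_1}E'$ and $F\xrightarrow{b\sharp_2}F'$ imply $E|F\xrightarrow{b\sharp}E'|F'$, where $\sharp=\sharp_1\circ\sharp_2$ with $!\circ?=?\circ!=!$, $?\circ?=?$ and $!\circ!$ undefined (no rule instance); (Rel) $E\xrightarrow{\ell}E'$ implies $E[f]\xrightarrow{f(\ell)}E'[f]$; (Res) $E\xrightarrow{\ell}E'$ with $\ell\notin\{c,\bar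 c\}$ implies $E\backslash c\xrightarrow{\ell}E'\backslash c$; (Rec) $P\xrightarrow{\ell}E'$ and $A\stackrel{def}{=}P$ imply $A\xrightarrow{\ell}E'$. Strong bisimilarity is the standard notion on this labelled transition system. -}

module Defs where

open import Data.Product using (Σ; ∃; _×_; _,_)
open import Data.Empty using (⊥)
open import Data.Unit using (⊤)
open import Relation.Binary.PropositionalEquality using (_≡_)
open import Relation.Nullary using (¬_)

data H (𝒞 : Set) : Set where
  plain : 𝒞 → H 𝒞
  bar   : 𝒞 → H 𝒞

co : {𝒞 : Set} → H 𝒞 → H 𝒞
co (plain c) = bar c
co (bar c)   = plain c

data Act (ℬ 𝒞 : Set) : Set where
  _!  : ℬ → Act ℬ 𝒞
  _⁇  : ℬ → Act ℬ 𝒞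
  hs  : H 𝒞 → Act ℬ 𝒞
  τ   : Act ℬ 𝒞

record Relabelling (ℬ 𝒞 : Set) : Set where
  constructor relab
  field
    fB : ℬ → ℬ
    fC : 𝒞 → 𝒞

relH : {ℬ 𝒞 : Set} → Relabelling ℬ 𝒞 → H 𝒞 → H 𝒞
relH f (plain c) = plain (Relabelling.fC f c)
relH f (bar c)   = bar (Relabelling.fC f c)

relAct : {ℬ 𝒞 : Set} → Relabelling ℬ 𝒞 → Act ℬ 𝒞 → Act ℬ 𝒞
relAct f (b !) = Relabelling.fB f b !
relAct f (b ⁇) = Relabelling.fB f b ⁇
relAct f (hs h) = hs (relH f h)
relAct f τ = τ

data Expr (𝒜 ℬ 𝒞 : Set) : Set where
  𝟎    : Expr 𝒜 ℬ 𝒞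
  _∙_  : Act ℬ 𝒞 → Expr 𝒜 ℬ 𝒞 → Expr 𝒜 ℬ 𝒞
  _⊕_  : Expr 𝒜 ℬ 𝒞 → Expr 𝒜 ℬ 𝒞 → Expr 𝒜 ℬ 𝒞
  _∥_  : Expr 𝒜 ℬ 𝒞 → Expr 𝒜 ℬ 𝒞 → Expr 𝒜 ℬ 𝒞
  _∖_  : Expr 𝒜 ℬ 𝒞 → H 𝒞 → Expr 𝒜 ℬ 𝒞
  _[_] : Expr 𝒜 ℬ 𝒞 → Relabelling ℬ 𝒞 → Expr 𝒜 ℬ 𝒞
  ag   : 𝒜 → Expr 𝒜 ℬ 𝒞

Guarded : {𝒜 ℬ 𝒞 : Set} → Expr 𝒜 ℬ 𝒞 → Set
Guarded 𝟎 = ⊤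
Guarded (α ∙ E) = ⊤
Guarded (E ⊕ F) = Guarded E × Guarded F
Guarded (E ∥ F) = Guarded E × Guarded F
Guarded (E ∖ c) = Guarded E
Guarded (E [ f ]) = Guarded E
Guarded (ag A) = ⊥

-- Broadcast composition ♯₁ ∘ ♯₂ (! ∘ ! undefined: no constructor)
data Sharp : Set where
  snd rcv : Sharp

sharpAct : {ℬ 𝒞 : Set} → ℬ → Sharp → Act ℬ 𝒞
sharpAct b snd = b !
sharpAct b rcv = b ⁇

data Compose : Sharp → Sharp → Sharp → Set where
  s∘r : Compose snd rcv snd
  r∘s : Compose rcv snd snd
  r∘r : Compose rcv rcv rcv

module Semantics {𝒜 ℬ 𝒞 : Set} (def : 𝒜 → Expr 𝒜 ℬ 𝒞) where

  Exp : Set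
  Exp = Expr 𝒜 ℬ 𝒞

  -- "E has an outgoing b?-transition", defined inductively by the same
  -- rules as the transition relation restricted to receive actions
  -- (the negative premises of Bro-l/Bro-r).
  data CanRecv : Exp → ℬ → Set where
    r-act  : ∀ {b E} → CanRecv ((b ⁇) ∙ E) b
    r-suml : ∀ {b E F} → CanRecv E b → CanRecv (E ⊕ F) b
    r-sumr : ∀ {b E F} → CanRecv F b → CanRecv (E ⊕ F) b
    r-parl : ∀ {b E F} → CanRecv E b → CanRecv (E ∥ F) b
    r-parr : ∀ {b E F} → CanRecv F b → CanRecv (E ∥ F) b
    r-res  : ∀ {b E c} → CanRecv E b → CanRecv (E ∖ c) b
    r-rel  : ∀ {b E f} → CanRecv E b → CanRecv (E [ f ]) (Relabelling.fB f b)
    r-rec  : ∀ {b A} → CanRecv (def A) b → CanRecv (ag A) b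

  data _—[_]→_ : Exp → Act ℬ 𝒞 → Exp → Set where
    act   : ∀ {α E} → (α ∙ E) —[ α ]→ E
    sum-l : ∀ {α E E' F} → E —[ α ]→ E' → (E ⊕ F) —[ α ]→ E'
    sum-r : ∀ {α E F F'} → F —[ α ]→ F' → (E ⊕ F) —[ α ]→ F'
    par-l-h : ∀ {h E E' F} → E —[ hs h ]→ E' → (E ∥ F) —[ hs h ]→ (E' ∥ F)
    par-l-τ : ∀ {E E' F} → E —[ τ ]→ E' → (E ∥ F) —[ τ ]→ (E' ∥ F)
    par-r-h : ∀ {h E F F'} → F —[ hs h ]→ F' → (E ∥ F) —[ hs h ]→ (E ∥ F')
    par-r-τ : ∀ {E F F'} → F —[ τ ]→ F' → (E ∥ F) —[ τ ]→ (E ∥ F')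
    comm  : ∀ {c E E' F F'} → E —[ hs c ]→ E' → F —[ hs (co c) ]→ F' →
            (E ∥ F) —[ τ ]→ (E' ∥ F')
    bro-l : ∀ {b s E E' F} → E —[ sharpAct b s ]→ E' → ¬ CanRecv F b →
            (E ∥ F) —[ sharpAct b s ]→ (E' ∥ F)
    bro-r : ∀ {b s E F F'} → F —[ sharpAct b s ]→ F' → ¬ CanRecv E b →
            (E ∥ F) —[ sharpAct b s ]→ (E ∥ F')
    bro-c : ∀ {b s₁ s₂ s E E' F F'} → Compose s₁ s₂ s →
            E —[ sharpAct b s₁ ]→ E' → F —[ sharpAct b s₂ ]→ F' →
            (E ∥ F) —[ sharpAct b s ]→ (E' ∥ F')
    rel   : ∀ {ℓ E E' f} → E —[ ℓ ]→ E' → (E [ f ]) —[ relAct f ℓ ]→ (E' [ f ])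
    res   : ∀ {ℓ E E' c} → E —[ ℓ ]→ E' → ¬ (ℓ ≡ hs c) → ¬ (ℓ ≡ hs (co c)) →
            (E ∖ c) —[ ℓ ]→ (E' ∖ c)
    rec   : ∀ {ℓ A E'} → def A —[ ℓ ]→ E' → ag A —[ ℓ ]→ E'

  IsBisimulation : (Exp → Exp → Set) → Set
  IsBisimulation R = ∀ {P Q} → R P Q →
    (∀ {α P'} → P —[ α ]→ P' → Σ Exp λ Q' → (Q —[ α ]→ Q') × R P' Q') ×
    (∀ {α Q'} → Q —[ α ]→ Q' → Σ Exp λ P' → (P —[ α ]→ P') × R P' Q')

  _∼_ : Exp → Exp → Set₁
  P ∼ Q = Σ (Exp → Exp → Set) λ R → IsBisimulation R × R P Q

-- The only non-routine operator is parallel composition, whose broadcast rules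
-- have the negative premise "the other component cannot receive b".  Bisimilar
-- processes have the same b?-transitions, so it suffices that CanRecv E b holds
-- exactly when E has a b?-transition.  One direction is immediate; for the other
-- only its double negation is constructive, which is all a negative premise
-- needs, and guardedness lets the induction unfold each agent at most once.
-- With that, a bisimulation S is closed under putting S-related processes into
-- one operator, and that closure is again a bisimulation.
module Submission where

open import Defs
open import Data.Product using (Σ; ∃; _×_; _,_; proj₁; proj₂; swap)
open import Function using (flip)
open import Relation.Binary.PropositionalEquality using (_≡_; refl)
open import Relation.Nullary using (¬_)
open import Relation.Nullary.Negation using (¬¬-map)

module Congruence {𝒜 ℬ 𝒞 : Set} (def : 𝒜 → Expr 𝒜 ℬ 𝒞)
                  (guarded : ∀ A → Guarded (def A)) where
  open Semantics def

  Receives : Exp → ℬ → Set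
  Receives E b = ∃ λ E' → E —[ b ⁇ ]→ E'

  receives⇒CanRecv : ∀ {E b} → Receives E b → CanRecv E b
  receives⇒CanRecv (_ , t) = go t refl
    where
    go : ∀ {E ℓ E' b} → E —[ ℓ ]→ E' → ℓ ≡ b ⁇ → CanRecv E b
    go act refl = r-act
    go (sum-l t) e = r-suml (go t e)
    go (sum-r t) e = r-sumr (go t e)
    go (bro-l t _) e = r-parl (go t e)
    go (bro-r t _) e = r-parr (go t e)
    go (bro-c r∘r t _) e = r-parl (go t e)
    go (rel {ℓ = _ ⁇} t) refl = r-rel (go t refl)
    go (res t _ _) e = r-res (go t e)
    go (rec t) e = r-rec (go t e)
    go (par-l-h _) ()
    go (par-l-τ _) ()
    go (par-r-h _) ()
    go (par-r-τ _) ()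
    go (comm _ _) ()
    go (bro-c s∘r _ _) ()
    go (bro-c r∘s _ _) ()
    go (rel {ℓ = _ !} _) ()
    go (rel {ℓ = hs _} _) ()
    go (rel {ℓ = τ} _) ()

  -- If F cannot receive, E alone broadcasts the receive (bro-l); if F can, it
  -- joins in (bro-c).
  receives-∥ˡ : ∀ {E F b} → Receives E b → (CanRecv F b → ¬ ¬ Receives F b) →
                ¬ ¬ Receives (E ∥ F) b
  receives-∥ˡ (E' , tE) F-receives ¬recv =
    ¬recv (_ , bro-l {s = rcv} tE λ cF →
      F-receives cF λ (F' , tF) → ¬recv (E' ∥ F' , bro-c r∘r tE tF))

  receives-∥ʳ : ∀ {E F b} → Receives F b → (CanRecv E b → ¬ ¬ Receives E b) →
                ¬ ¬ Receives (E ∥ F) b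
  receives-∥ʳ (F' , tF) E-receives ¬recv =
    ¬recv (_ , bro-r {s = rcv} tF λ cE →
      E-receives cE λ (E' , tE) → ¬recv (E' ∥ F' , bro-c r∘r tE tF))

  -- The ∥ cases recurse on a component with an arbitrary CanRecv proof, so the
  -- recursion is on E; unfolding an agent is not structural, hence the guarded
  -- variant that the general lemma below calls on agent definitions.
  CanRecv⇒¬¬receives-guarded : ∀ {b} E → Guarded E → CanRecv E b → ¬ ¬ Receives E b
  CanRecv⇒¬¬receives-guarded (_ ∙ E) _ r-act ¬recv = ¬recv (E , act)
  CanRecv⇒¬¬receives-guarded (E ⊕ F) (gE , _) (r-suml c) =
    ¬¬-map (λ (E' , t) → E' , sum-l t) (CanRecv⇒¬¬receives-guarded E gE c)
  CanRecv⇒¬¬receives-guarded (E ⊕ F) (_ , gF) (r-sumr c) =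
    ¬¬-map (λ (F' , t) → F' , sum-r t) (CanRecv⇒¬¬receives-guarded F gF c)
  CanRecv⇒¬¬receives-guarded (E ∥ F) (gE , gF) (r-parl c) ¬recv =
    CanRecv⇒¬¬receives-guarded E gE c λ r →
      receives-∥ˡ r (CanRecv⇒¬¬receives-guarded F gF) ¬recv
  CanRecv⇒¬¬receives-guarded (E ∥ F) (gE , gF) (r-parr c) ¬recv =
    CanRecv⇒¬¬receives-guarded F gF c λ r →
      receives-∥ʳ r (CanRecv⇒¬¬receives-guarded E gE) ¬recv
  CanRecv⇒¬¬receives-guarded (E ∖ h) g (r-res c) =
    ¬¬-map (λ (E' , t) → E' ∖ h , res t (λ ()) (λ ())) (CanRecv⇒¬¬receives-guarded E g c)
  CanRecv⇒¬¬receives-guarded (E [ f ]) g (r-rel c) =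
    ¬¬-map (λ (E' , t) → E' [ f ] , rel t) (CanRecv⇒¬¬receives-guarded E g c)

  CanRecv⇒¬¬receives : ∀ {b} E → CanRecv E b → ¬ ¬ Receives E b
  CanRecv⇒¬¬receives (_ ∙ E) r-act ¬recv = ¬recv (E , act)
  CanRecv⇒¬¬receives (E ⊕ F) (r-suml c) =
    ¬¬-map (λ (E' , t) → E' , sum-l t) (CanRecv⇒¬¬receives E c)
  CanRecv⇒¬¬receives (E ⊕ F) (r-sumr c) =
    ¬¬-map (λ (F' , t) → F' , sum-r t) (CanRecv⇒¬¬receives F c)
  CanRecv⇒¬¬receives (E ∥ F) (r-parl c) ¬recv =
    CanRecv⇒¬¬receives E c λ r → receives-∥ˡ r (CanRecv⇒¬¬receives F) ¬recv
  CanRecv⇒¬¬receives (E ∥ F) (r-parr c) ¬recv =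
    CanRecv⇒¬¬receives F c λ r → receives-∥ʳ r (CanRecv⇒¬¬receives E) ¬recv
  CanRecv⇒¬¬receives (E ∖ h) (r-res c) =
    ¬¬-map (λ (E' , t) → E' ∖ h , res t (λ ()) (λ ())) (CanRecv⇒¬¬receives E c)
  CanRecv⇒¬¬receives (E [ f ]) (r-rel c) =
    ¬¬-map (λ (E' , t) → E' [ f ] , rel t) (CanRecv⇒¬¬receives E c)
  CanRecv⇒¬¬receives (ag A) (r-rec c) =
    ¬¬-map (λ (E' , t) → E' , rec t) (CanRecv⇒¬¬receives-guarded (def A) (guarded A) c)

  Simulation : (Exp → Exp → Set) → Set
  Simulation R = ∀ {P Q} → R P Q →
    ∀ {α P'} → P —[ α ]→ P' → Σ Exp λ Q' → (Q —[ α ]→ Q') × R P' Q'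

  flip-isBisimulation : ∀ {S} → IsBisimulation S → IsBisimulation (flip S)
  flip-isBisimulation bis s = swap (bis s)

  ¬CanRecv-resp-simulation : ∀ {S X Y b} → Simulation (flip S) → S X Y →
                             ¬ CanRecv X b → ¬ CanRecv Y b
  ¬CanRecv-resp-simulation {Y = Y} sim s ¬cX cY =
    CanRecv⇒¬¬receives Y cY λ (_ , t) →
      ¬cX (receives⇒CanRecv (_ , proj₁ (proj₂ (sim s t))))

  -- Pairs that differ by S-related arguments of a single operator, S itself,
  -- and the identity (reached after a summand the other side shares).
  data OperatorStep (S : Exp → Exp → Set) : Exp → Exp → Set where
    base : ∀ {X Y} → S X Y → OperatorStep S X Y
    same : ∀ {X} → OperatorStep S X X
    ∙-cong : ∀ {α X Y} → S X Y → OperatorStep S (α ∙ X) (α ∙ Y)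
    ⊕-congʳ : ∀ {X Y Z} → S X Y → OperatorStep S (X ⊕ Z) (Y ⊕ Z)
    ⊕-congˡ : ∀ {X Y Z} → S X Y → OperatorStep S (Z ⊕ X) (Z ⊕ Y)
    ∥-congʳ : ∀ {X Y Z} → S X Y → OperatorStep S (X ∥ Z) (Y ∥ Z)
    ∥-congˡ : ∀ {X Y Z} → S X Y → OperatorStep S (Z ∥ X) (Z ∥ Y)
    ∖-cong : ∀ {X Y c} → S X Y → OperatorStep S (X ∖ c) (Y ∖ c)
    []-cong : ∀ {X Y f} → S X Y → OperatorStep S (X [ f ]) (Y [ f ])

  OperatorStep-flip : ∀ {S X Y} → OperatorStep S X Y → OperatorStep (flip S) Y X
  OperatorStep-flip (base s) = base s
  OperatorStep-flip same = same
  OperatorStep-flip (∙-cong s) = ∙-cong s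
  OperatorStep-flip (⊕-congʳ s) = ⊕-congʳ s
  OperatorStep-flip (⊕-congˡ s) = ⊕-congˡ s
  OperatorStep-flip (∥-congʳ s) = ∥-congʳ s
  OperatorStep-flip (∥-congˡ s) = ∥-congˡ s
  OperatorStep-flip (∖-cong s) = ∖-cong s
  OperatorStep-flip ([]-cong s) = []-cong s

  OperatorStep-simulation : ∀ {S} → IsBisimulation S → Simulation (OperatorStep S)
  OperatorStep-simulation {S} bis = simulate
    where
    sim : Simulation S
    sim s = proj₁ (bis s)

    ¬CanRecv-resp : ∀ {X Y b} → S X Y → ¬ CanRecv X b → ¬ CanRecv Y b
    ¬CanRecv-resp = ¬CanRecv-resp-simulation (λ s → proj₂ (bis s))

    simulate-∥ʳ : ∀ {X Y Z} → S X Y → ∀ {α P'} → (X ∥ Z) —[ α ]→ P' →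
                  Σ Exp λ Q' → ((Y ∥ Z) —[ α ]→ Q') × OperatorStep S P' Q'
    simulate-∥ʳ s (par-l-h t) = let (_ , t' , s') = sim s t in _ , par-l-h t' , ∥-congʳ s'
    simulate-∥ʳ s (par-l-τ t) = let (_ , t' , s') = sim s t in _ , par-l-τ t' , ∥-congʳ s'
    simulate-∥ʳ s (par-r-h u) = _ , par-r-h u , ∥-congʳ s
    simulate-∥ʳ s (par-r-τ u) = _ , par-r-τ u , ∥-congʳ s
    simulate-∥ʳ s (comm t u) = let (_ , t' , s') = sim s t in _ , comm t' u , ∥-congʳ s'
    simulate-∥ʳ s (bro-l t ¬cZ) = let (_ , t' , s') = sim s t in _ , bro-l t' ¬cZ , ∥-congʳ s'
    simulate-∥ʳ s (bro-r u ¬cX) = _ , bro-r u (¬CanRecv-resp s ¬cX) , ∥-congʳ s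
    simulate-∥ʳ s (bro-c k t u) = let (_ , t' , s') = sim s t in _ , bro-c k t' u , ∥-congʳ s'

    simulate-∥ˡ : ∀ {X Y Z} → S X Y → ∀ {α P'} → (Z ∥ X) —[ α ]→ P' →
                  Σ Exp λ Q' → ((Z ∥ Y) —[ α ]→ Q') × OperatorStep S P' Q'
    simulate-∥ˡ s (par-r-h t) = let (_ , t' , s') = sim s t in _ , par-r-h t' , ∥-congˡ s'
    simulate-∥ˡ s (par-r-τ t) = let (_ , t' , s') = sim s t in _ , par-r-τ t' , ∥-congˡ s'
    simulate-∥ˡ s (par-l-h u) = _ , par-l-h u , ∥-congˡ s
    simulate-∥ˡ s (par-l-τ u) = _ , par-l-τ u , ∥-congˡ s
    simulate-∥ˡ s (comm u t) = let (_ , t' , s') = sim s t in _ , comm u t' , ∥-congˡ s'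
    simulate-∥ˡ s (bro-r t ¬cZ) = let (_ , t' , s') = sim s t in _ , bro-r t' ¬cZ , ∥-congˡ s'
    simulate-∥ˡ s (bro-l u ¬cX) = _ , bro-l u (¬CanRecv-resp s ¬cX) , ∥-congˡ s
    simulate-∥ˡ s (bro-c k u t) = let (_ , t' , s') = sim s t in _ , bro-c k u t' , ∥-congˡ s'

    simulate : Simulation (OperatorStep S)
    simulate (base s) t = let (_ , t' , s') = sim s t in _ , t' , base s'
    simulate same t = _ , t , same
    simulate (∙-cong s) act = _ , act , base s
    simulate (⊕-congʳ s) (sum-l t) = let (_ , t' , s') = sim s t in _ , sum-l t' , base s'
    simulate (⊕-congʳ s) (sum-r u) = _ , sum-r u , same
    simulate (⊕-congˡ s) (sum-r t) = let (_ , t' , s') = sim s t in _ , sum-r t' , base s'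
    simulate (⊕-congˡ s) (sum-l u) = _ , sum-l u , same
    simulate (∥-congʳ s) t = simulate-∥ʳ s t
    simulate (∥-congˡ s) t = simulate-∥ˡ s t
    simulate (∖-cong s) (res t ¬c ¬c̄) =
      let (_ , t' , s') = sim s t in _ , res t' ¬c ¬c̄ , ∖-cong s'
    simulate ([]-cong s) (rel t) = let (_ , t' , s') = sim s t in _ , rel t' , []-cong s'

  OperatorStep-isBisimulation : ∀ {S} → IsBisimulation S → IsBisimulation (OperatorStep S)
  OperatorStep-isBisimulation bis r =
    OperatorStep-simulation bis r ,
    λ t → let (_ , t' , r') = OperatorStep-simulation (flip-isBisimulation bis) (OperatorStep-flip r) t
          in _ , t' , OperatorStep-flip r'

theorem1 : (𝒜 ℬ 𝒞 : Set) (def : 𝒜 → Expr 𝒜 ℬ 𝒞) → (∀ A → Guarded (def A)) →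
    let open Semantics def in
    ∀ (P Q R : Expr 𝒜 ℬ 𝒞) (α : Act ℬ 𝒞) (c : H 𝒞) (f : Relabelling ℬ 𝒞) →
    P ∼ Q →
    ((α ∙ P) ∼ (α ∙ Q)) × ((P ⊕ R) ∼ (Q ⊕ R)) × ((R ⊕ P) ∼ (R ⊕ Q)) ×
    ((P ∥ R) ∼ (Q ∥ R)) × ((R ∥ P) ∼ (R ∥ Q)) × ((P ∖ c) ∼ (Q ∖ c)) ×
    ((P [ f ]) ∼ (Q [ f ]))
theorem1 𝒜 ℬ 𝒞 def guarded P Q R α c f (S , bis , s) =
  step (∙-cong s) , step (⊕-congʳ s) , step (⊕-congˡ s) , step (∥-congʳ s) ,
  step (∥-congˡ s) , step (∖-cong s) , step ([]-cong s)
  where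
  open Congruence def guarded
  open Semantics def using (_∼_)

  step : ∀ {X Y} → OperatorStep S X Y → X ∼ Y
  step r = OperatorStep S , OperatorStep-isBisimulation bis , r
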